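{- Let $G_1,\ldots,G_n$ be nondeterministic automata, where $G_i$ has set of secret states $Q_i^S$, and consider the composed system $G_1\|\cdots\|G_n$ with interaction $\|_\land$, i.e. with set of secret states $Q^S=Q_1^S\times\cdots\times Q_n^S$. Let $\sim$ be an opaque observation equivalence on $G_1$ and $\tilde G_1$ the quotient automaton of $G_1$ modulo $\sim$. Then $G_1\|\cdots\|G_n$ is infinite-step opaque if and only if $\tilde G_1\|G_2\|\cdots\|G_n$ is infinite-step opaque (with secret states defined in the same $\|_\land$ manner).
   Context: An automaton is $G=\langle\Sigma_\tau,Q,\to,Q^\circ\rangle$ with finite set $\Sigma$ of observable events, a special unobservable event $\tau\notin\Sigma$, $\Sigma_\tau=\Sigma\cup\{\tau\}$, finite states $Q$, transitions $\to\subseteq Q\times\Sigma_\tau\times Q$, initial states $Q^\circ$; it carries secret states $Q^S\subseteq Q$ and $Q^{NS}=Q\setminus Q^S$. For $s\in\Sigma^*$, $p\stackrel{s}{\Rightarrow}q$ means there is $t\in\Sigma_\tau^*$ which becomes $s$ after deleting all $\tau$'s and $p\stackrel{t}{\to}q$; $p\stackrel{s}{\Rightarrow}$ means $p\stackrel{s}{\Rightarrow}q$ for some $q$; $L(G,q)=\{s\in\Sigma^*:q\stackrel{s}{\Rightarrow}\}$. Synchronous composition: states are tuples, initial states products of initial states; an event in $\Sigma$ shared by components is executed jointly by all components having it in their alphabet; other events (including $\tau$, never shared) are executed by a single component while the others stay put. Infinite-step opacity: $G$ is infinite-step opaque w.r.t. $Q^S$ iff for every $q^\circ\in Q^\circ$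 and all $s,t\in\Sigma^*$ with $st\in L(G,q^\circ)$ and $q^\circ\stackrel{s}{\Rightarrow}Q^S$, there exist $q'^\circ\in Q^\circ$ and $y\in Q^{NS}$ with $q'^\circ\stackrel{s}{\Rightarrow}y$ and $y\stackrel{t}{\Rightarrow}$. Opaque observation equivalence: an equivalence relation $\sim$ on $Q$ such that whenever $x_1\sim x_2$: (i) if $x_1\stackrel{s}{\Rightarrow}y_1$ for some $s\in\Sigma^*$, then there is $y_2$ with $x_2\stackrel{s}{\Rightarrow}y_2$ and $y_1\sim y_2$; (ii) $x_1\in Q^S$ iff $x_2\in Q^S$. Quotient automaton modulo $\sim$: states are the classes $[x]$, $([x],\sigma,[y])$ is a transition iff $x'\stackrel{\sigma}{\to}y'$ for some $x'\in[x]$, $y'\in[y]$, initial states $\{[x^\circ]:x^\circ\in Q^\circ\}$; a class $[x]$ is secret iff $x\in Q^S$. -}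

module Defs where

open import Data.Nat using (ℕ; suc)
open import Data.Fin using (Fin; zero)
open import Data.Fin as F using ()
open import Data.Maybe using (Maybe; just; nothing)
open import Data.List using (List; []; _∷_; _++_; catMaybes)
open import Data.Product using (Σ; ∃; ∃-syntax; _×_; _,_)
open import Data.Sum using (_⊎_)
open import Relation.Nullary using (¬_)
open import Relation.Binary using (IsEquivalence)
open import Relation.Binary.PropositionalEquality using (_≡_)
open import Function.Bundles using (_↔_)

Finite : Set → Set
Finite A = ∃[ k ] (A ↔ Fin k)

-- Events: a global type E of observable events; labels are Maybe E,
-- where 'nothing' is the unobservable event τ.
Label : Set → Set
Label E = Maybe E

τ : {E : Set} → Label E
τ = nothing

record Automaton (E : Set) : Set₁ where
  field
    Alph   : E → Set
    State  : Set
    Step   : State → Label E → State → Set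
    Init   : State → Set
    Secret : State → Set
    step-alph : ∀ {x e y} → Step x (just e) y → Alph e
open Automaton public

FiniteAutomaton : {E : Set} → Automaton E → Set
FiniteAutomaton {E} A = Finite (State A) × Finite E

module _ {E : Set} (A : Automaton E) where

  data Path : State A → List (Label E) → State A → Set where
    [] : ∀ {x} → Path x [] x
    _∷_ : ∀ {x l y t z} → Step A x l y → Path y t z → Path x (l ∷ t) z

  _⇒[_]_ : State A → List E → State A → Set
  p ⇒[ s ] q = ∃[ t ] (catMaybes t ≡ s × Path p t q)

  _⇒[_] : State A → List E → Set
  p ⇒[ s ] = ∃[ q ] (p ⇒[ s ] q)

  L : State A → List E → Set
  L q s = q ⇒[ s ]

  InfStepOpaque : Set
  InfStepOpaque =
    ∀ (q° : State A) (s t : List E) → Init A q° →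
    L q° (s ++ t) →
    (∃[ q ] (q° ⇒[ s ] q × Secret A q)) →
    ∃[ q'° ] ∃[ y ] (Init A q'° × q'° ⇒[ s ] y × ¬ Secret A y × y ⇒[ t ])

  record OpaqueObsEquiv (_~_ : State A → State A → Set) : Set where
    field
      isEquivalence : IsEquivalence _~_
      sim : ∀ {x₁ x₂ y₁ s} → x₁ ~ x₂ → x₁ ⇒[ s ] y₁ →
            ∃[ y₂ ] (x₂ ⇒[ s ] y₂ × y₁ ~ y₂)
      secret-iff : ∀ {x₁ x₂} → x₁ ~ x₂ → (Secret A x₁ → Secret A x₂) × (Secret A x₂ → Secret A x₁)

  -- Quotient automaton modulo _~_, in setoid style: a state x stands for its
  -- class [x]; transitions/initiality are defined on classes
  -- ([x] -σ-> [y] iff x' -σ-> y' for some x' ~ x, y' ~ y; [x] initial iff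
  -- [x] = [x°] for an initial x°), and [x] is secret iff x ∈ Q^S.
  Quotient : (_~_ : State A → State A → Set) → Automaton E
  Quotient _~_ = record
    { Alph   = Alph A
    ; State  = State A
    ; Step   = λ x l y → ∃[ x' ] ∃[ y' ] (x ~ x' × y ~ y' × Step A x' l y')
    ; Init   = λ x → ∃[ x° ] (Init A x° × x ~ x°)
    ; Secret = Secret A
    ; step-alph = λ { (_ , _ , _ , _ , st) → step-alph A st }
    }

Compose∧ : {E : Set} {n : ℕ} → (Fin n → Automaton E) → Automaton E
Compose∧ {E} {n} G = record
  { Alph   = λ e → ∃[ i ] Alph (G i) e
  ; State  = (i : Fin n) → State (G i)
  ; Step   = step
  ; Init   = λ x → ∀ i → Init (G i) (x i)
  ; Secret = λ x → ∀ i → Secret (G i) (x i)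
  ; step-alph = λ { (a , _) → a }
  }
  where
  step : ((i : Fin n) → State (G i)) → Label E → ((i : Fin n) → State (G i)) → Set
  step x (just e) y =
    (∃[ i ] Alph (G i) e) ×
    (∀ i → (Alph (G i) e × Step (G i) (x i) (just e) (y i))
         ⊎ (¬ Alph (G i) e × y i ≡ x i))
  step x nothing y =
    ∃[ i ] (Step (G i) (x i) nothing (y i) × (∀ j → ¬ j ≡ i → y j ≡ x j))

replace₀ : {E : Set} {n : ℕ} → (Fin (suc n) → Automaton E) → Automaton E →
           Fin (suc n) → Automaton E
replace₀ G A zero    = A
replace₀ G A (F.suc i) = G (F.suc i)

module Submission where

-- An 'OpaqueBisimulation' between two automata (a
--     relation matching weak transitions in both directions, initial states in
--     both directions, and respecting secrecy) transfers infinite-step opacity;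
--     since the notion is symmetric, opacity is invariant under it.
--  3. The composed systems.  Relate a state x of G₁‖⋯‖Gₙ to a state z of
--     G̃₁‖G₂‖⋯‖Gₙ when x₁ ~ z₁ and the remaining components coincide.  A step of
--     the original system is a step of the quotient system; conversely a
--     quotient step of the first component is matched, via the simulation
--     property of ~, by a weak run of G₁, which is lifted into the composition
--     by running G₁'s τ-moves alone around the synchronised event.

open import Defs
open import Data.Nat using (ℕ; suc)
open import Data.Fin using (Fin; zero)
open import Data.Fin as F using ()
open import Data.Product using (_×_; ∃-syntax; _,_; proj₁; proj₂)
open import Data.Sum using (_⊎_; inj₁; inj₂)
open import Data.Maybe using (just; nothing)
open import Data.List using (List; []; _∷_; _++_; catMaybes)
open import Data.Empty using (⊥-elim)
open import Relation.Nullary using (¬_)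
open import Relation.Binary using (IsEquivalence)
open import Relation.Binary.PropositionalEquality using (_≡_; refl; sym; trans; subst; cong)
open import Function.Bundles using (_⇔_; mk⇔)

obs : {E : Set} → Label E → List E
obs nothing  = []
obs (just e) = e ∷ []

data Trace {E : Set} (A : Automaton E) : State A → List E → State A → Set where
  []  : ∀ {x} → Trace A x [] x
  τ∷  : ∀ {x y s z} → Step A x nothing y → Trace A y s z → Trace A x s z
  e∷  : ∀ {x e y s z} → Step A x (just e) y → Trace A y s z → Trace A x (e ∷ s) z

module _ {E : Set} (A : Automaton E) where

  trace⇒weak : ∀ {x s y} → Trace A x s y → _⇒[_]_ A x s y
  trace⇒weak [] = [] , refl , []
  trace⇒weak (τ∷ st tr) =
    let (t , erased , path) = trace⇒weak tr in nothing ∷ t , erased , st ∷ path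
  trace⇒weak (e∷ {e = e} st tr) =
    let (t , erased , path) = trace⇒weak tr in just e ∷ t , cong (e ∷_) erased , st ∷ path

  path⇒trace : ∀ {x t y} → Path A x t y → Trace A x (catMaybes t) y
  path⇒trace [] = []
  path⇒trace (_∷_ {l = nothing} st path) = τ∷ st (path⇒trace path)
  path⇒trace (_∷_ {l = just e} st path) = e∷ st (path⇒trace path)

  weak⇒trace : ∀ {x s y} → _⇒[_]_ A x s y → Trace A x s y
  weak⇒trace (t , refl , path) = path⇒trace path

  step⇒trace : ∀ {x l y} → Step A x l y → Trace A x (obs l) y
  step⇒trace {l = nothing} st = τ∷ st []
  step⇒trace {l = just e} st = e∷ st []

  _++ᵗ_ : ∀ {x s y s' z} → Trace A x s y → Trace A y s' z → Trace A x (s ++ s') z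
  [] ++ᵗ tr' = tr'
  (τ∷ st tr) ++ᵗ tr' = τ∷ st (tr ++ᵗ tr')
  (e∷ st tr) ++ᵗ tr' = e∷ st (tr ++ᵗ tr')

  split-single : ∀ {x e z} → Trace A x (e ∷ []) z →
                 ∃[ a ] ∃[ b ] (Trace A x [] a × Step A a (just e) b × Trace A b [] z)
  split-single (τ∷ st tr) =
    let (a , b , before , st' , after) = split-single tr in a , b , τ∷ st before , st' , after
  split-single (e∷ st tr) = _ , _ , [] , st , tr

weak-simulation : {E : Set} {A B : Automaton E} {R : State A → State B → Set} →
  (∀ {x z l y} → R x z → Step A x l y → ∃[ w ] (Trace B z (obs l) w × R y w)) →
  ∀ {x z s y} → R x z → _⇒[_]_ A x s y → ∃[ w ] (_⇒[_]_ B z s w × R y w)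
weak-simulation {A = A} {B} {R} match r weak =
  let (w , tr , r') = simulate r (weak⇒trace A weak) in w , trace⇒weak B tr , r'
  where
  simulate : ∀ {x z s y} → R x z → Trace A x s y → ∃[ w ] (Trace B z s w × R y w)
  simulate r [] = _ , [] , r
  simulate r (τ∷ st tr) =
    let (w₁ , tr₁ , r₁) = match r st ; (w , tr' , r') = simulate r₁ tr
    in w , _++ᵗ_ B tr₁ tr' , r'
  simulate r (e∷ st tr) =
    let (w₁ , tr₁ , r₁) = match r st ; (w , tr' , r') = simulate r₁ tr
    in w , _++ᵗ_ B tr₁ tr' , r'

record OpaqueBisimulation {E : Set} (A B : Automaton E)
                          (R : State A → State B → Set) : Set where
  field
    forth : ∀ {x z s y} → R x z → _⇒[_]_ A x s y → ∃[ w ] (_⇒[_]_ B z s w × R y w)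
    back  : ∀ {x z s w} → R x z → _⇒[_]_ B z s w → ∃[ y ] (_⇒[_]_ A x s y × R y w)
    secret-forth : ∀ {x z} → R x z → Secret A x → Secret B z
    secret-back  : ∀ {x z} → R x z → Secret B z → Secret A x
    init-forth : ∀ {x} → Init A x → ∃[ z ] (Init B z × R x z)
    init-back  : ∀ {z} → Init B z → ∃[ x ] (Init A x × R x z)

flip-bisimulation : {E : Set} {A B : Automaton E} {R : State A → State B → Set} →
                    OpaqueBisimulation A B R → OpaqueBisimulation B A (λ z x → R x z)
flip-bisimulation bisim = record
  { forth = back ; back = forth
  ; secret-forth = secret-back ; secret-back = secret-forth
  ; init-forth = init-back ; init-back = init-forth }
  where open OpaqueBisimulation bisim

-- An observation of B that reveals a secret is pulled back to A, where
-- opacity supplies a non-secret alibi; the alibi is pushed forward to B.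
transfer-opacity : {E : Set} {A B : Automaton E} {R : State A → State B → Set} →
                   OpaqueBisimulation A B R → InfStepOpaque A → InfStepOpaque B
transfer-opacity bisim opaqueA z° s t z°-init (_ , z°⇒st) (zq , z°⇒zq , zq-secret) =
  let (x° , x°-init , x°Rz°) = init-back z°-init
      (xl , x°⇒st , _) = back x°Rz° z°⇒st
      (xq , x°⇒xq , xqRzq) = back x°Rz° z°⇒zq
      (x'° , y , x'°-init , x'°⇒y , y-public , (v , y⇒v)) =
        opaqueA x° s t x°-init (xl , x°⇒st) (xq , x°⇒xq , secret-back xqRzq zq-secret)
      (z'° , z'°-init , x'°Rz'°) = init-forth x'°-init
      (w , z'°⇒w , yRw) = forth x'°Rz'° x'°⇒y
      (u , w⇒u , _) = forth yRw y⇒v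
  in z'° , w , z'°-init , z'°⇒w
     , (λ w-secret → y-public (secret-back yRw w-secret)) , (u , w⇒u)
  where open OpaqueBisimulation bisim

opacity-invariant : {E : Set} {A B : Automaton E} {R : State A → State B → Set} →
                    OpaqueBisimulation A B R → InfStepOpaque A ⇔ InfStepOpaque B
opacity-invariant bisim =
  mk⇔ (transfer-opacity bisim) (transfer-opacity (flip-bisimulation bisim))

SyncMove : {E : Set} (A : Automaton E) → E → State A → State A → Set
SyncMove A e p r = (Alph A e × Step A p (just e) r) ⊎ (¬ Alph A e × r ≡ p)

SyncMove-from : {E : Set} (A : Automaton E) {e : E} {p q r : State A} →
                p ≡ q → SyncMove A e q r → SyncMove A e p r
SyncMove-from A refl move = move

module HeadRuns {E : Set} {n : ℕ} (F : Fin (suc n) → Automaton E) where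

  C : Automaton E
  C = Compose∧ F

  _◂_ : State (F zero) → State C → State C
  (a ◂ x) zero = a
  (a ◂ x) (F.suc i) = x (F.suc i)

  SameTail : State C → State C → Set
  SameTail y x = ∀ i → y (F.suc i) ≡ x (F.suc i)

  lift-τ-run : ∀ x {b} → Trace (F zero) (x zero) [] b →
               ∃[ y ] (Trace C x [] y × y zero ≡ b × SameTail y x)
  lift-τ-run x [] = x , [] , refl , λ _ → refl
  lift-τ-run x (τ∷ {y = a} st tr) =
    let (y , run , y-head , y-tail) = lift-τ-run (a ◂ x) tr
    in y , τ∷ head-step run , y-head , y-tail
    where
    head-step : Step C x nothing (a ◂ x)
    head-step = zero , st , λ { zero ne → ⊥-elim (ne refl) ; (F.suc j) _ → refl }

  -- If the first component can observe e weakly while the others react to e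
  -- by moving to y, the composition observes e and ends in y's tail: the first
  -- component runs its τ-moves alone before and after the joint e-step.
  lift-sync-run : ∀ x y {e b} → Alph (F zero) e → Trace (F zero) (x zero) (e ∷ []) b →
                  (∀ i → SyncMove (F (F.suc i)) e (x (F.suc i)) (y (F.suc i))) →
                  ∃[ y' ] (Trace C x (e ∷ []) y' × y' zero ≡ b × SameTail y' y)
  lift-sync-run x y {e} in-alph run tails =
    let (a , a' , before , st , after) = split-single (F zero) run
        (x₁ , run₁ , x₁-head , x₁-tail) = lift-τ-run x before
        (y' , run₂ , y'-head , y'-tail) = lift-τ-run (a' ◂ y) after
        joint : Step C x₁ (just e) (a' ◂ y)
        joint = (zero , in-alph)
              , λ { zero → inj₁ (in-alph ,
                             subst (λ u → Step (F zero) u (just e) a') (sym x₁-head) st)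
                  ; (F.suc i) → SyncMove-from (F (F.suc i)) (x₁-tail i) (tails i) }
    in y' , _++ᵗ_ C run₁ (e∷ joint run₂) , y'-head , y'-tail

module QuotientReplacement {E : Set} {n : ℕ} (G : Fin (suc n) → Automaton E)
  (_~_ : State (G zero) → State (G zero) → Set)
  (equiv : OpaqueObsEquiv (G zero) _~_) where

  open OpaqueObsEquiv equiv
  open IsEquivalence isEquivalence renaming (refl to ~-refl; sym to ~-sym; trans to ~-trans)
  open HeadRuns G using (_◂_; lift-τ-run; lift-sync-run)
  open HeadRuns (replace₀ G (Quotient (G zero) _~_)) using () renaming (_◂_ to _◂ᴰ_)

  Q : Automaton E
  Q = Quotient (G zero) _~_

  C D : Automaton E
  C = Compose∧ G
  D = Compose∧ (replace₀ G Q)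

  toD : State C → State D
  toD x zero = x zero
  toD x (F.suc i) = x (F.suc i)

  toC : State D → State C
  toC z zero = z zero
  toC z (F.suc i) = z (F.suc i)

  alph-toD : ∀ {e} → ∃[ i ] Alph (G i) e → Alph D e
  alph-toD (zero , a) = zero , a
  alph-toD (F.suc i , a) = F.suc i , a

  alph-toC : ∀ {e} → Alph D e → ∃[ i ] Alph (G i) e
  alph-toC (zero , a) = zero , a
  alph-toC (F.suc i , a) = F.suc i , a

  _≈_ : State C → State D → Set
  x ≈ z = x zero ~ z zero × (∀ i → x (F.suc i) ≡ z (F.suc i))

  quotient-step-back : ∀ {x a l b} → x ~ a → Step Q a l b →
                       ∃[ c ] (Trace (G zero) x (obs l) c × c ~ b)
  quotient-step-back x~a (a' , b' , a~a' , b~b' , st) =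
    let (c , x⇒c , b'~c) = sim (~-sym (~-trans x~a a~a')) (step⇒weak st)
    in c , weak⇒trace (G zero) x⇒c , ~-sym (~-trans b~b' b'~c)
    where
    step⇒weak : ∀ {p l q} → Step (G zero) p l q → _⇒[_]_ (G zero) p (obs l) q
    step⇒weak st = trace⇒weak (G zero) (step⇒trace (G zero) st)

  step-forth : ∀ {x z l y} → x ≈ z → Step C x l y → ∃[ w ] (Step D z l w × y ≈ w)
  step-forth {x} {z} {nothing} {y} (head , tail) (zero , st , still) =
    y zero ◂ᴰ z ,
    (zero , (x zero , y zero , ~-sym head , ~-refl , st) ,
      λ { zero ne → ⊥-elim (ne refl) ; (F.suc j) _ → refl }) ,
    (~-refl , λ j → trans (still (F.suc j) (λ ())) (tail j))
  step-forth {x} {z} {nothing} {y} (head , tail) (F.suc k , st , still) =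
    z zero ◂ᴰ toD y ,
    (F.suc k , subst (λ u → Step (G (F.suc k)) u nothing (y (F.suc k))) (tail k) st ,
      λ { zero _ → refl ; (F.suc m) ne → trans (still (F.suc m) ne) (tail m) }) ,
    (subst (_~ z zero) (sym (still zero (λ ()))) head , λ _ → refl)
  step-forth {x} {z} {just e} {y} (head , tail) (in-alph , moves) with moves zero
  ... | inj₁ (a , st) =
    toD y ,
    (alph-toD in-alph ,
      λ { zero → inj₁ (a , (x zero , y zero , ~-sym head , ~-refl , st))
        ; (F.suc i) → SyncMove-from (G (F.suc i)) (sym (tail i)) (moves (F.suc i)) }) ,
    (~-refl , λ _ → refl)
  ... | inj₂ (not-a , stays) =
    z zero ◂ᴰ toD y ,
    (alph-toD in-alph ,
      λ { zero → inj₂ (not-a , refl)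
        ; (F.suc i) → SyncMove-from (G (F.suc i)) (sym (tail i)) (moves (F.suc i)) }) ,
    (subst (_~ z zero) (sym stays) head , λ _ → refl)

  step-back : ∀ {x z l w} → x ≈ z → Step D z l w →
              ∃[ y ] (Trace C x (obs l) y × y ≈ w)
  step-back {x} {z} {nothing} {w} (head , tail) (zero , st , still) =
    let (c , run , c~w) = quotient-step-back head st
        (y , run' , y-head , y-tail) = lift-τ-run x run
    in y , run' ,
       (subst (_~ w zero) (sym y-head) c~w ,
        λ i → trans (y-tail i) (trans (tail i) (sym (still (F.suc i) (λ ())))))
  step-back {x} {z} {nothing} {w} (head , tail) (F.suc k , st , still) =
    x zero ◂ toC w ,
    τ∷ (F.suc k , subst (λ u → Step (G (F.suc k)) u nothing (w (F.suc k))) (sym (tail k)) st ,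
        λ { zero _ → refl ; (F.suc m) ne → trans (still (F.suc m) ne) (sym (tail m)) }) [] ,
    (subst (x zero ~_) (sym (still zero (λ ()))) head , λ _ → refl)
  step-back {x} {z} {just e} {w} (head , tail) (in-alph , moves) with moves zero
  ... | inj₁ (a , st) =
    let (c , run , c~w) = quotient-step-back head st
        (y , run' , y-head , y-tail) =
          lift-sync-run x (toC w) a run
            (λ i → SyncMove-from (G (F.suc i)) (tail i) (moves (F.suc i)))
    in y , run' , (subst (_~ w zero) (sym y-head) c~w , y-tail)
  ... | inj₂ (not-a , stays) =
    x zero ◂ toC w ,
    e∷ (alph-toC in-alph ,
        λ { zero → inj₂ (not-a , refl)
          ; (F.suc i) → SyncMove-from (G (F.suc i)) (tail i) (moves (F.suc i)) }) [] ,
    (subst (x zero ~_) (sym stays) head , λ _ → refl)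

  ≈-secret-forth : ∀ {x z} → x ≈ z → Secret C x → Secret D z
  ≈-secret-forth (head , tail) secret zero = proj₁ (secret-iff head) (secret zero)
  ≈-secret-forth (head , tail) secret (F.suc i) =
    subst (Secret (G (F.suc i))) (tail i) (secret (F.suc i))

  ≈-secret-back : ∀ {x z} → x ≈ z → Secret D z → Secret C x
  ≈-secret-back (head , tail) secret zero = proj₂ (secret-iff head) (secret zero)
  ≈-secret-back (head , tail) secret (F.suc i) =
    subst (Secret (G (F.suc i))) (sym (tail i)) (secret (F.suc i))

  ≈-init-forth : ∀ {x} → Init C x → ∃[ z ] (Init D z × x ≈ z)
  ≈-init-forth {x} init = toD x , toD-init , (~-refl , λ _ → refl)
    where
    toD-init : Init D (toD x)
    toD-init zero = x zero , init zero , ~-refl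
    toD-init (F.suc i) = init (F.suc i)

  ≈-init-back : ∀ {z} → Init D z → ∃[ x ] (Init C x × x ≈ z)
  ≈-init-back {z} init =
    let (x° , x°-init , z~x°) = init zero
    in x° ◂ toC z , (λ { zero → x°-init ; (F.suc i) → init (F.suc i) }) ,
       (~-sym z~x° , λ _ → refl)

  bisimulation : OpaqueBisimulation C D _≈_
  bisimulation = record
    { forth = weak-simulation (λ r st → let (w , st' , r') = step-forth r st
                                        in w , step⇒trace D st' , r')
    ; back = λ r → weak-simulation {R = λ z x → x ≈ z} step-back r
    ; secret-forth = ≈-secret-forth
    ; secret-back = ≈-secret-back
    ; init-forth = ≈-init-forth
    ; init-back = ≈-init-back
    }

corollary4 : {E : Set} {n : ℕ} (G : Fin (suc n) → Automaton E) →
             (∀ i → FiniteAutomaton (G i)) →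
             (_~_ : State (G zero) → State (G zero) → Set) →
             OpaqueObsEquiv (G zero) _~_ →
             InfStepOpaque (Compose∧ G) ⇔
               InfStepOpaque (Compose∧ (replace₀ G (Quotient (G zero) _~_)))
corollary4 G _ _~_ equiv = opacity-invariant (QuotientReplacement.bisimulation G _~_ equiv)
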